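{- Let $M$ be a partial TP matrix and $u$ an unspecified position of $M$ such that no real value placed at $u$ makes the resulting partial matrix partial TP. Let $U=\{u\}$. Then every inhibiting set for $(M,U)$ consists of exactly two $U$-atoms, one positive and one negative.
   Context: A partial matrix is a rectangular array some of whose entries are real numbers (specified) and others unspecified; it is partial TP if every square submatrix (rows and columns arbitrary, not necessarily contiguous) consisting only of specified entries has positive determinant. For a set $U$ of unspecified positions, a $U$-atom is a square submatrix $S$ with row set $R$ and column set $C$ such that: (a) every unspecified entry of $S$ lies in $U$, and $S$ contains at least one unspecified entry; (b) for each column $c\notin C$ with $\min C<c<\max C$, some position $(r,c)$ with $r\in R$ is unspecified and not in $U$; (c) for each row $r\notin R$ with $\min R<r<\max R$, some position $(r,c)$ with $c\in C$ is unspecified and not in $U$. An inhibiting set for $(M,U)$ is a set $A$ of $U$-atoms of smallest possible size such that the system $\{\det S(\mathbf{u})>0\mid S\in A\}$ (determinants as functions of the variables at the positions of $U$) has no real solution. When $U=\{u\}$, a $U$-atom is called positive if $u$ occupies position $(i,j)$ of the atom (indices relative to the atom) with $i+j$ even, and negative if $i+j$ is odd. -}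

module Defs where

open import Level using (0ℓ)
open import Data.Nat using (ℕ; zero; suc; _%_) renaming (_+_ to _+ℕ_; _≤_ to _≤ℕ_)
open import Data.Fin using (Fin; zero; suc; toℕ; fromℕ; punchIn) renaming (_<_ to _<F_; _≟_ to _≟F_)
open import Data.Maybe using (Maybe; just; nothing; fromMaybe)
open import Data.Product using (Σ; _×_; _,_; ∃; ∃-syntax)
open import Data.List using (List; length)
open import Data.List.Relation.Unary.All using (All)
open import Data.List.Relation.Unary.Any using (Any)
open import Data.List.Membership.Propositional using (_∈_)
open import Relation.Nullary using (¬_; yes; no)
open import Relation.Nullary.Decidable using (_×-dec_)
open import Relation.Binary.PropositionalEquality using (_≡_; _≢_)
open import Relation.Binary.Structures using (IsStrictTotalOrder)
open import Algebra.Structures using (IsCommutativeRing)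

-- The real numbers, given axiomatically as a complete ordered field
-- (any model of these axioms is isomorphic to ℝ).

record RealField : Set₁ where
  infixl 6 _+_
  infixl 7 _*_
  infix 4 _<_
  field
    Carrier : Set
    _+_ _*_ : Carrier → Carrier → Carrier
    -_      : Carrier → Carrier
    0# 1#   : Carrier
    isCommutativeRing : IsCommutativeRing _≡_ _+_ _*_ -_ 0# 1#
    _<_     : Carrier → Carrier → Set
    isStrictTotalOrder : IsStrictTotalOrder _≡_ _<_
    0≢1     : 0# ≢ 1#
    inverse : ∀ x → x ≢ 0# → ∃[ y ] (x * y ≡ 1#)
    +-mono-< : ∀ {x y} z → x < y → x + z < y + z
    *-pos   : ∀ {x y} → 0# < x → 0# < y → 0# < x * y
    sup     : (P : Carrier → Set) → ∃[ x ] P x → ∃[ b ] (∀ x → P x → ¬ (b < x)) →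
              ∃[ s ] ((∀ x → P x → ¬ (s < x)) ×
                      (∀ b → (∀ x → P x → ¬ (b < x)) → ¬ (b < s)))

module _ (ℝ : RealField) where
  open RealField ℝ

  sumFin : ∀ {k} → (Fin k → Carrier) → Carrier
  sumFin {zero}  f = 0#
  sumFin {suc k} f = f zero + sumFin (λ j → f (suc j))

  signFin : ∀ {k} → Fin k → Carrier
  signFin zero    = 1#
  signFin (suc j) = - signFin j

  det : ∀ {k} → (Fin k → Fin k → Carrier) → Carrier
  det {zero}  A = 1#
  det {suc k} A = sumFin (λ j → signFin j * A zero j *
                          det (λ a b → A (suc a) (punchIn j b)))

  -- Partial matrices: nothing = unspecified entry.

  PMat : ℕ → ℕ → Set
  PMat m n = Fin m → Fin n → Maybe Carrier

  Increasing : ∀ {k m} → (Fin k → Fin m) → Set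
  Increasing {k} f = ∀ (a b : Fin k) → a <F b → f a <F f b

  PartialTP : ∀ {m n} → PMat m n → Set
  PartialTP {m} {n} M =
    ∀ (k : ℕ) (r : Fin k → Fin m) (c : Fin k → Fin n) →
    Increasing r → Increasing c →
    (A : Fin k → Fin k → Carrier) →
    (∀ a b → M (r a) (c b) ≡ just (A a b)) →
    0# < det A

  Pos : ℕ → ℕ → Set
  Pos m n = Fin m × Fin n

  fill : ∀ {m n} → PMat m n → Pos m n → Carrier → PMat m n
  fill M (i₀ , j₀) x i j with (i ≟F i₀) ×-dec (j ≟F j₀)
  ... | yes _ = just x
  ... | no  _ = M i j

  record SqSub (m n : ℕ) : Set where
    constructor sq
    field
      size   : ℕ          -- the submatrix is (suc size) × (suc size)
      rows   : Fin (suc size) → Fin m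
      cols   : Fin (suc size) → Fin n
      rowsInc : Increasing rows
      colsInc : Increasing cols
  open SqSub public

  -- U-atom for U = {u}.
  IsAtom : ∀ {m n} → PMat m n → Pos m n → SqSub m n → Set
  IsAtom {m} {n} M u S =
    (∀ a b → M (rows S a) (cols S b) ≡ nothing → (rows S a , cols S b) ≡ u) ×
    (∃[ a ] ∃[ b ] (M (rows S a) (cols S b) ≡ nothing)) ×
    (∀ (c : Fin n) → (∀ b → cols S b ≢ c) →
       cols S zero <F c → c <F cols S (fromℕ (size S)) →
       ∃[ a ] (M (rows S a) c ≡ nothing × (rows S a , c) ≢ u)) ×
    (∀ (r : Fin m) → (∀ a → rows S a ≢ r) →
       rows S zero <F r → r <F rows S (fromℕ (size S)) →
       ∃[ b ] (M r (cols S b) ≡ nothing × (r , cols S b) ≢ u))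

  -- det S(x): the determinant of S with the value x placed at u.
  -- (Entries unspecified in M other than u never occur for atoms;
  -- they are read as 0# only to make the function total.)
  atomDet : ∀ {m n} → PMat m n → Pos m n → SqSub m n → Carrier → Carrier
  atomDet M u S x =
    det (λ a b → fromMaybe 0# (fill M u x (rows S a) (cols S b)))

  Solvable : ∀ {m n} → PMat m n → Pos m n → List (SqSub m n) → Set
  Solvable M u A = ∃[ x ] All (λ S → 0# < atomDet M u S x) A

  Inhibiting : ∀ {m n} → PMat m n → Pos m n → List (SqSub m n) → Set
  Inhibiting {m} {n} M u A =
    All (IsAtom M u) A × ¬ Solvable M u A ×
    (∀ (B : List (SqSub m n)) → All (IsAtom M u) B → ¬ Solvable M u B →
       length A ≤ℕ length B)

  -- Positive / negative atoms (parity of the relative position of u;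
  -- 0- vs 1-based indexing does not change the parity of i+j).
  PositiveAtom : ∀ {m n} → Pos m n → SqSub m n → Set
  PositiveAtom u S =
    ∃[ a ] ∃[ b ] ((rows S a , cols S b) ≡ u × (toℕ a +ℕ toℕ b) % 2 ≡ 0)

  NegativeAtom : ∀ {m n} → Pos m n → SqSub m n → Set
  NegativeAtom u S =
    ∃[ a ] ∃[ b ] ((rows S a , cols S b) ≡ u × (toℕ a +ℕ toℕ b) % 2 ≡ 1)

-- For U = {u}, the determinant of a U-atom S as a function of the value x placed at u is
-- affine, det S(x) = ±D·x + K: expanding along the entry u, D is the determinant of the
-- complementary minor, a fully specified submatrix of the partial TP matrix and hence
-- positive, and the sign is (-1)^(i+j) for the relative position (i, j) of u in S.  So a
-- positive atom holds exactly on a half-line (t, ∞) and a negative one exactly on (-∞, t).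
-- A finite family of such half-lines with empty intersection already contains an upward and
-- a downward half-line that are disjoint (take the largest lower threshold and the smallest
-- upper one); minimality of an inhibiting set then leaves exactly these two atoms.

module Submission where

open import Defs
open import Level using (0ℓ)
open import Data.Nat using (ℕ; zero; suc; s≤s; z≤n; _%_) renaming (_+_ to _+ℕ_; _≤_ to _≤ℕ_)
open import Data.Nat.Properties using (m≤n⇒m≤1+n; ≤-antisym)
open import Data.Nat.DivMod using (%-distribˡ-+)
open import Data.Fin using (Fin; zero; suc; toℕ; punchIn; punchOut) renaming (_<_ to _<F_; _≟_ to _≟F_)
import Data.Fin.Properties as Fin
open import Data.Fin.Properties using (punchInᵢ≢i; punchIn-injective; punchIn-punchOut)
open import Data.Maybe using (Maybe; just; nothing; fromMaybe)
open import Data.Product using (curry; ∃₂; ∃-syntax; Σ-syntax; _×_; _,_; proj₁; proj₂)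
open import Data.Product.Properties using (×-≡,≡←≡)
open import Data.Sum using (_⊎_; inj₁; inj₂; swap)
import Data.Sum as Sum
open import Data.Empty using (⊥; ⊥-elim)
open import Data.List using (List; []; _∷_; length)
open import Data.List.Relation.Unary.All as All using (All; []; _∷_)
open import Data.List.Relation.Unary.Any using (Any; here; there)
open import Data.List.Membership.Propositional using (_∈_; lose)
open import Function using (_∘_; _⇔_; mk⇔; Equivalence)
open import Algebra.Bundles using (CommutativeRing; CommutativeMonoid)
import Algebra.Properties.CommutativeSemigroup as CommutativeSemigroupProperties
import Algebra.Properties.Ring as RingProperties
import Function.Properties.Equivalence as Equiv
import Algebra.Solver.CommutativeMonoid as CommutativeMonoidSolver
open import Relation.Nullary using (¬_; yes; no)
open import Relation.Nullary.Decidable using (_×-dec_)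
open import Relation.Binary.Core using (Rel)
open import Relation.Binary.Definitions using (tri<; tri≈; tri>)
open import Relation.Binary.Structures using (IsStrictTotalOrder)
import Relation.Binary.Construct.Flip.EqAndOrd as Flip
open import Relation.Binary.PropositionalEquality

open Equivalence using (to; from)

module HalfLines {A : Set} {_<_ : Rel A 0ℓ} (sto : IsStrictTotalOrder _≡_ _<_)
                 {I : Set} (Sat : A → I → Set) where

  open IsStrictTotalOrder sto using (compare; _<?_; asym) renaming (trans to <-trans)

  Above Below HalfLine : I → Set
  Above i = Σ[ t ∈ A ] (∀ x → Sat x i ⇔ t < x)
  Below i = Σ[ t ∈ A ] (∀ x → Sat x i ⇔ x < t)
  HalfLine i = Above i ⊎ Below i

  StrongestAbove : I → List I → Set
  StrongestAbove p is = ∀ x → Sat x p → All (λ i → Below i ⊎ Sat x i) is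

  ≯-<-trans : ∀ {x y z} → ¬ (y < x) → y < z → x < z
  ≯-<-trans {x} {z = z} y≮x y<z with compare x z
  ... | tri< x<z _ _  = x<z
  ... | tri≈ _ refl _ = ⊥-elim (y≮x y<z)
  ... | tri> _ _ z<x  = ⊥-elim (y≮x (<-trans y<z z<x))

  above-⊆ : ∀ {i j} → ((s , _) : Above i) → ((t , _) : Above j) → ¬ (s < t) →
            ∀ {x} → Sat x i → Sat x j
  above-⊆ (s , above-i) (t , above-j) s≮t {x} sat = above-j x .from (≯-<-trans s≮t (above-i x .to sat))

  strongest-above : ∀ is → All HalfLine is →
                    All Below is ⊎ ∃[ p ] (p ∈ is × Above p × StrongestAbove p is)
  strongest-above []       []       = inj₁ []
  strongest-above (i ∷ is) (h ∷ hs) with h | strongest-above is hs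
  ... | inj₂ below-i | inj₁ below = inj₁ (below-i ∷ below)
  ... | inj₁ above-i | inj₁ below =
    inj₂ (i , here refl , above-i , λ x sat → inj₂ sat ∷ All.map inj₁ below)
  ... | inj₂ below-i | inj₂ (p , p∈ , above-p , strongest) =
    inj₂ (p , there p∈ , above-p , λ x sat → inj₁ below-i ∷ strongest x sat)
  ... | inj₁ above-i | inj₂ (p , p∈ , above-p , strongest) with proj₁ above-i <? proj₁ above-p
  ...   | yes tᵢ<tₚ = inj₂ (p , there p∈ , above-p , λ x sat →
                        inj₂ (above-⊆ above-p above-i (asym tᵢ<tₚ) sat) ∷ strongest x sat)
  ...   | no  tᵢ≮tₚ = inj₂ (i , here refl , above-i , λ x sat →
                        inj₂ sat ∷ strongest x (above-⊆ above-i above-p tᵢ≮tₚ sat))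

module Helly {A : Set} {_<_ : Rel A 0ℓ} (sto : IsStrictTotalOrder _≡_ _<_)
           (no-max : ∀ t → ∃[ x ] t < x) (no-min : ∀ t → ∃[ x ] x < t) (x₀ : A)
           {I : Set} (Sat : A → I → Set) where

  open IsStrictTotalOrder sto using (_<?_; asym) renaming (trans to <-trans)
  open HalfLines sto Sat

  upper-bound : ∀ s t → ∃[ x ] (s < x × t < x)
  upper-bound s t with s <? t
  ... | yes s<t = let (x , t<x) = no-max t in x , <-trans s<t t<x , t<x
  ... | no  s≮t = let (x , s<x) = no-max s in x , s<x , ≯-<-trans s≮t s<x

  above-below-disjoint : ∀ i → Above i → Below i → ⊥
  above-below-disjoint _ (s , above) (t , below) =
    let (x , s<x , t<x) = upper-bound s t in asym t<x (below x .to (above x .from s<x))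

  open HalfLines (Flip.isStrictTotalOrder sto) Sat
    using () renaming (strongest-above to strongest-below)

  satisfied-by-both : ∀ {x is} → All (λ i → Below i ⊎ Sat x i) is →
                      All (λ i → Above i ⊎ Sat x i) is → All (Sat x) is
  satisfied-by-both = curry (All.zipWith both)
    where
    both : ∀ {x i} → (Below i ⊎ Sat x i) × (Above i ⊎ Sat x i) → Sat x i
    both         (inj₂ sat   , _)           = sat
    both         (inj₁ _     , inj₂ sat)    = sat
    both {i = i} (inj₁ below , inj₁ above) = ⊥-elim (above-below-disjoint i above below)

  helly : ∀ is → All HalfLine is → ¬ (∃[ x ] All (Sat x) is) →
          ∃₂ λ p q → p ∈ is × q ∈ is × Above p × Below q × ¬ (∃[ x ] (Sat x p × Sat x q))
  helly is hs unsolvable with strongest-above is hs | strongest-below is (All.map swap hs)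
  ... | inj₂ (p , p∈ , above-p , strongest-p) | inj₂ (q , q∈ , below-q , strongest-q) =
    p , q , p∈ , q∈ , above-p , below-q ,
    λ (x , sat-p , sat-q) → unsolvable (x , satisfied-by-both (strongest-p x sat-p) (strongest-q x sat-q))
  ... | inj₁ below | inj₂ (q , _ , (t , below-t) , strongest-q) =
    let (x , x<t) = no-min t in
    ⊥-elim (unsolvable (x , satisfied-by-both (All.map inj₁ below) (strongest-q x (below-t x .from x<t))))
  ... | inj₂ (p , _ , (t , above-t) , strongest-p) | inj₁ above =
    let (x , t<x) = no-max t in
    ⊥-elim (unsolvable (x , satisfied-by-both (strongest-p x (above-t x .from t<x)) (All.map inj₁ above)))
  ... | inj₁ below | inj₁ above =
    ⊥-elim (unsolvable (x₀ , satisfied-by-both (All.map inj₁ below) (All.map inj₁ above)))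

distinct-members⇒2≤length : ∀ {A : Set} {x y : A} {xs} → x ∈ xs → y ∈ xs → x ≢ y → 2 ≤ℕ length xs
distinct-members⇒2≤length (here refl)            (here refl)            x≢y = ⊥-elim (x≢y refl)
distinct-members⇒2≤length (here _)               (there {xs = _ ∷ _} _) _   = s≤s (s≤s z≤n)
distinct-members⇒2≤length (there {xs = _ ∷ _} _) (here _)               _   = s≤s (s≤s z≤n)
distinct-members⇒2≤length (there x∈)             (there y∈)             x≢y =
  m≤n⇒m≤1+n (distinct-members⇒2≤length x∈ y∈ x≢y)

module OrderedField (ℝ : RealField) where

  open RealField ℝ
  open ≡-Reasoning

  commutativeRing : CommutativeRing 0ℓ 0ℓ
  commutativeRing = record { isCommutativeRing = isCommutativeRing }

  open CommutativeRing commutativeRing public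
    using (+-assoc; +-comm; +-identityˡ; +-identityʳ; -‿inverseˡ; -‿inverseʳ;
           *-assoc; *-comm; *-identityˡ; *-identityʳ; zeroˡ; zeroʳ; distribˡ; distribʳ; ring;
           +-commutativeMonoid)
  open RingProperties ring public using (-‿distribˡ-*; -‿distribʳ-*; -‿involutive)
  open CommutativeSemigroupProperties (CommutativeMonoid.commutativeSemigroup +-commutativeMonoid) public
    using () renaming (interchange to +-interchange)
  open IsStrictTotalOrder isStrictTotalOrder public
    using (compare; asym) renaming (trans to <-trans; irrefl to <-irrefl)

  -x*-y≡x*y : ∀ x y → - x * - y ≡ x * y
  -x*-y≡x*y x y = begin
    - x * - y      ≡⟨ sym (-‿distribˡ-* x (- y)) ⟩
    - (x * - y)    ≡⟨ cong -_ (sym (-‿distribʳ-* x y)) ⟩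
    - - (x * y)    ≡⟨ -‿involutive (x * y) ⟩
    x * y          ∎

  neg-pos : ∀ {z} → 0# < z → - z < 0#
  neg-pos {z} 0<z = subst₂ _<_ (+-identityˡ (- z)) (-‿inverseʳ z) (+-mono-< (- z) 0<z)

  pos-neg : ∀ {z} → z < 0# → 0# < - z
  pos-neg {z} z<0 = subst₂ _<_ (-‿inverseʳ z) (+-identityˡ (- z)) (+-mono-< (- z) z<0)

  -- if 1 < 0 then 0 < -1, hence 0 < (-1)(-1) = 1
  0<1 : 0# < 1#
  0<1 with compare 0# 1#
  ... | tri< 0<1 _ _ = 0<1
  ... | tri≈ _ 0≡1 _ = ⊥-elim (0≢1 0≡1)
  ... | tri> _ _ 1<0 = ⊥-elim (asym 1<0 1<0⇒0<1)
    where
    1<0⇒0<1 : 0# < 1#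
    1<0⇒0<1 = subst (0# <_) (trans (-x*-y≡x*y 1# 1#) (*-identityˡ 1#)) (*-pos (pos-neg 1<0) (pos-neg 1<0))

  unbounded-above : ∀ t → ∃[ x ] t < x
  unbounded-above t = 1# + t , subst (_< 1# + t) (+-identityˡ t) (+-mono-< t 0<1)

  unbounded-below : ∀ t → ∃[ x ] x < t
  unbounded-below t = - 1# + t , subst (- 1# + t <_) (+-identityˡ t) (+-mono-< t (neg-pos 0<1))

  0<x-t⇔t<x : ∀ {x t} → 0# < x + - t ⇔ t < x
  0<x-t⇔t<x {x} {t} = mk⇔
    (subst₂ _<_ (+-identityˡ t) x-t+t≡x ∘ +-mono-< t)
    (subst (_< x + - t) (-‿inverseʳ t) ∘ +-mono-< (- t))
    where
    x-t+t≡x : x + - t + t ≡ x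
    x-t+t≡x = trans (+-assoc x (- t) t) (trans (cong (x +_) (-‿inverseˡ t)) (+-identityʳ x))

  0<c*z⇔0<z : ∀ {c z} → 0# < c → 0# < c * z ⇔ 0# < z
  0<c*z⇔0<z {c} {z} 0<c = mk⇔ cancel (*-pos 0<c)
    where
    cancel : 0# < c * z → 0# < z
    cancel 0<cz with compare 0# z
    ... | tri< 0<z _ _ = 0<z
    ... | tri≈ _ refl _ = ⊥-elim (<-irrefl refl (subst (0# <_) (zeroʳ c) 0<cz))
    ... | tri> _ _ z<0 =
      ⊥-elim (asym 0<cz (subst (_< 0#) (-‿involutive (c * z))
        (neg-pos (subst (0# <_) (sym (-‿distribʳ-* c z)) (*-pos 0<c (pos-neg z<0))))))

  cofactor-sign-exchange : ∀ {s s′ t u} a e d → s * s′ ≡ - (t * u) →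
                           s * e * (a * s′ * d) ≡ - a * t * (u * e * d)
  cofactor-sign-exchange {s} {s′} {t} {u} a e d ss′≡-tu = begin
    s * e * (a * s′ * d)       ≡⟨ solve 5 (λ s e a s′ d → (s ⊕ e) ⊕ ((a ⊕ s′) ⊕ d)
                                                      ⊜ (s ⊕ s′) ⊕ (a ⊕ (e ⊕ d))) refl s e a s′ d ⟩
    s * s′ * (a * (e * d))     ≡⟨ cong (_* (a * (e * d))) ss′≡-tu ⟩
    - (t * u) * (a * (e * d))  ≡⟨ sym (-‿distribˡ-* (t * u) (a * (e * d))) ⟩
    - (t * u * (a * (e * d)))  ≡⟨ cong -_ (solve 5 (λ t u a e d → (t ⊕ u) ⊕ (a ⊕ (e ⊕ d))
                                                      ⊜ (a ⊕ t) ⊕ ((u ⊕ e) ⊕ d)) refl t u a e d) ⟩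
    - (a * t * (u * e * d))    ≡⟨ -‿distribˡ-* (a * t) (u * e * d) ⟩
    - (a * t) * (u * e * d)    ≡⟨ cong (_* (u * e * d)) (-‿distribˡ-* a t) ⟩
    - a * t * (u * e * d)      ∎
    where
    open CommutativeMonoidSolver (CommutativeRing.*-commutativeMonoid commutativeRing) using (solve; _⊜_; _⊕_)

  *-cancel-inverse : ∀ {c c⁻¹} k → c * c⁻¹ ≡ 1# → c * (k * c⁻¹) ≡ k
  *-cancel-inverse {c} {c⁻¹} k c*c⁻¹≡1 = begin
    c * (k * c⁻¹)  ≡⟨ sym (*-assoc c k c⁻¹) ⟩
    c * k * c⁻¹    ≡⟨ cong (_* c⁻¹) (*-comm c k) ⟩
    k * c * c⁻¹    ≡⟨ *-assoc k c c⁻¹ ⟩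
    k * (c * c⁻¹)  ≡⟨ cong (k *_) c*c⁻¹≡1 ⟩
    k * 1#         ≡⟨ *-identityʳ k ⟩
    k              ∎

  Affine : (Carrier → Carrier) → Carrier → Set
  Affine f c = Σ[ k ∈ Carrier ] (∀ x → f x ≡ c * x + k)

  affine-above : ∀ {f c} → 0# < c → Affine f c → Σ[ t ∈ Carrier ] (∀ x → 0# < f x ⇔ t < x)
  affine-above {f} {c} 0<c (k , f≡) with inverse c (λ c≡0 → <-irrefl (sym c≡0) 0<c)
  ... | c⁻¹ , c*c⁻¹≡1 = - (k * c⁻¹) , λ x →
    subst (λ y → 0# < y ⇔ - (k * c⁻¹) < x) (sym (f≡c*[x-t] x)) (Equiv.trans (0<c*z⇔0<z 0<c) 0<x-t⇔t<x)
    where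
    f≡c*[x-t] : ∀ x → f x ≡ c * (x + - - (k * c⁻¹))
    f≡c*[x-t] x = begin
      f x                      ≡⟨ f≡ x ⟩
      c * x + k                ≡⟨ cong (c * x +_) (sym (*-cancel-inverse k c*c⁻¹≡1)) ⟩
      c * x + c * (k * c⁻¹)    ≡⟨ sym (distribˡ c x (k * c⁻¹)) ⟩
      c * (x + k * c⁻¹)        ≡⟨ cong (λ z → c * (x + z)) (sym (-‿involutive (k * c⁻¹))) ⟩
      c * (x + - - (k * c⁻¹))  ∎

  affine-below : ∀ {f c} → 0# < c → Affine f (- c) → Σ[ t ∈ Carrier ] (∀ x → 0# < f x ⇔ x < t)
  affine-below {f} {c} 0<c (k , f≡) with inverse c (λ c≡0 → <-irrefl (sym c≡0) 0<c)
  ... | c⁻¹ , c*c⁻¹≡1 = k * c⁻¹ , λ x →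
    subst (λ y → 0# < y ⇔ x < k * c⁻¹) (sym (f≡c*[t-x] x)) (Equiv.trans (0<c*z⇔0<z 0<c) 0<x-t⇔t<x)
    where
    f≡c*[t-x] : ∀ x → f x ≡ c * (k * c⁻¹ + - x)
    f≡c*[t-x] x = begin
      f x                      ≡⟨ f≡ x ⟩
      - c * x + k              ≡⟨ +-comm (- c * x) k ⟩
      k + - c * x              ≡⟨ cong₂ _+_ (sym (*-cancel-inverse k c*c⁻¹≡1)) (sym (-‿distribˡ-* c x)) ⟩
      c * (k * c⁻¹) + - (c * x)  ≡⟨ cong (c * (k * c⁻¹) +_) (-‿distribʳ-* c x) ⟩
      c * (k * c⁻¹) + c * - x  ≡⟨ sym (distribˡ c (k * c⁻¹) (- x)) ⟩
      c * (k * c⁻¹ + - x)      ∎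

  affine-const : ∀ k → Affine (λ _ → k) 0#
  affine-const k = k , λ x → sym (trans (cong (_+ k) (zeroˡ x)) (+-identityˡ k))

  affine-+ : ∀ {f g c d} → Affine f c → Affine g d → Affine (λ x → f x + g x) (c + d)
  affine-+ {f} {g} {c} {d} (k , f≡) (l , g≡) = k + l , λ x → begin
    f x + g x                 ≡⟨ cong₂ _+_ (f≡ x) (g≡ x) ⟩
    (c * x + k) + (d * x + l) ≡⟨ +-interchange (c * x) k (d * x) l ⟩
    (c * x + d * x) + (k + l) ≡⟨ cong (_+ (k + l)) (sym (distribʳ x c d)) ⟩
    (c + d) * x + (k + l)     ∎

  affine-scale : ∀ {f c} a → Affine f c → Affine (λ x → a * f x) (a * c)
  affine-scale {f} {c} a (k , f≡) = a * k , λ x → begin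
    a * f x              ≡⟨ cong (a *_) (f≡ x) ⟩
    a * (c * x + k)      ≡⟨ distribˡ a (c * x) k ⟩
    a * (c * x) + a * k  ≡⟨ cong (_+ a * k) (sym (*-assoc a c x)) ⟩
    a * c * x + a * k    ∎

  affine-sumFin : ∀ {k} {f : Fin k → Carrier → Carrier} {c : Fin k → Carrier} →
    (∀ j → Affine (f j) (c j)) → Affine (λ x → sumFin ℝ (λ j → f j x)) (sumFin ℝ c)
  affine-sumFin {zero}  _   = affine-const 0#
  affine-sumFin {suc k} aff = affine-+ (aff zero) (affine-sumFin (aff ∘ suc))

  affine-resp : ∀ {f g c d} → (∀ x → f x ≡ g x) → c ≡ d → Affine f c → Affine g d
  affine-resp f≗g refl (k , f≡) = k , λ x → trans (sym (f≗g x)) (f≡ x)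

module Determinant (ℝ : RealField) where

  open RealField ℝ
  open OrderedField ℝ
  open ≡-Reasoning
  open CommutativeMonoidSolver (CommutativeRing.*-commutativeMonoid commutativeRing)
    using (solve; _⊜_; _⊕_; id)

  Mat : ℕ → Set
  Mat k = Fin k → Fin k → Carrier

  minor : ∀ {k} → Fin (suc k) → Fin (suc k) → Mat (suc k) → Mat k
  minor a b A r c = A (punchIn a r) (punchIn b c)

  laplace-term : ∀ {k} → Mat (suc k) → Fin (suc k) → Carrier
  laplace-term A j = signFin ℝ j * A zero j * det ℝ (minor zero j A)

  sumFin-cong : ∀ {k} {f g : Fin k → Carrier} → (∀ j → f j ≡ g j) → sumFin ℝ f ≡ sumFin ℝ g
  sumFin-cong {zero}  f≗g = refl
  sumFin-cong {suc k} f≗g = cong₂ _+_ (f≗g zero) (sumFin-cong (f≗g ∘ suc))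

  det-cong : ∀ {k} {A B : Mat k} → (∀ r c → A r c ≡ B r c) → det ℝ A ≡ det ℝ B
  det-cong {zero}  A≗B = refl
  det-cong {suc k} A≗B = sumFin-cong λ j →
    cong₂ (λ e d → signFin ℝ j * e * d) (A≗B zero j) (det-cong λ r c → A≗B (suc r) (punchIn j c))

  sumFin-punchIn : ∀ {k} (f : Fin (suc k) → Carrier) b → sumFin ℝ f ≡ f b + sumFin ℝ (f ∘ punchIn b)
  sumFin-punchIn f       zero    = refl
  sumFin-punchIn {suc k} f (suc b) = begin
    f zero + sumFin ℝ (f ∘ suc)           ≡⟨ cong (f zero +_) (sumFin-punchIn (f ∘ suc) b) ⟩
    f zero + (f (suc b) + rest)           ≡⟨ sym (+-assoc (f zero) (f (suc b)) rest) ⟩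
    f zero + f (suc b) + rest             ≡⟨ cong (_+ rest) (+-comm (f zero) (f (suc b))) ⟩
    f (suc b) + f zero + rest             ≡⟨ +-assoc (f (suc b)) (f zero) rest ⟩
    f (suc b) + (f zero + rest)           ∎
    where
    rest = sumFin ℝ (f ∘ suc ∘ punchIn b)

  *-distribˡ-sumFin : ∀ {k} c (f : Fin k → Carrier) → c * sumFin ℝ f ≡ sumFin ℝ (λ j → c * f j)
  *-distribˡ-sumFin {zero}  c f = zeroʳ c
  *-distribˡ-sumFin {suc k} c f =
    trans (distribˡ c (f zero) _) (cong (c * f zero +_) (*-distribˡ-sumFin c (f ∘ suc)))

  punchIn-punchIn-punchOut : ∀ {k} (b : Fin (suc (suc k))) j c (p : punchIn b j ≢ b) →
    punchIn (punchIn b j) (punchIn (punchOut p) c) ≡ punchIn b (punchIn j c)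
  punchIn-punchIn-punchOut zero    j       c       p = refl
  punchIn-punchIn-punchOut (suc b) zero    c       p = refl
  punchIn-punchIn-punchOut (suc b) (suc j) zero    p = refl
  punchIn-punchIn-punchOut (suc b) (suc j) (suc c) p =
    cong suc (punchIn-punchIn-punchOut b j c (p ∘ cong suc))

  signFin-punchIn-punchOut : ∀ {k} (b : Fin (suc k)) j (p : punchIn b j ≢ b) →
    signFin ℝ (punchIn b j) * signFin ℝ (punchOut p) ≡ - (signFin ℝ b * signFin ℝ j)
  signFin-punchIn-punchOut {suc k} zero    j       p =
    trans (*-identityʳ _) (cong -_ (sym (*-identityˡ _)))
  signFin-punchIn-punchOut         (suc b) zero    p =
    trans (*-identityˡ _) (trans (sym (-‿involutive _)) (cong -_ (sym (*-identityʳ _))))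
  signFin-punchIn-punchOut         (suc b) (suc j) p = begin
    - signFin ℝ (punchIn b j) * - signFin ℝ (punchOut (p ∘ cong suc))  ≡⟨ -x*-y≡x*y _ _ ⟩
    signFin ℝ (punchIn b j) * signFin ℝ (punchOut (p ∘ cong suc))      ≡⟨ signFin-punchIn-punchOut b j _ ⟩
    - (signFin ℝ b * signFin ℝ j)                                      ≡⟨ cong -_ (sym (-x*-y≡x*y _ _)) ⟩
    - (- signFin ℝ b * - signFin ℝ j)                                  ∎

  VariesOnlyAt : ∀ {k} → Fin k → Fin k → (Carrier → Mat k) → Set
  VariesOnlyAt a b A = ∀ x y r c → ¬ (r ≡ a × c ≡ b) → A x r c ≡ A y r c

  module _ {k} {a b : Fin (suc k)} {A : Carrier → Mat (suc k)} (varies : VariesOnlyAt a b A) where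

    det-minor-row-stable : ∀ b′ x y → det ℝ (minor a b′ (A x)) ≡ det ℝ (minor a b′ (A y))
    det-minor-row-stable b′ x y = det-cong λ r c → varies x y _ _ (punchInᵢ≢i a r ∘ proj₁)

    det-minor-col-stable : ∀ a′ x y → det ℝ (minor a′ b (A x)) ≡ det ℝ (minor a′ b (A y))
    det-minor-col-stable a′ x y = det-cong λ r c → varies x y _ _ (punchInᵢ≢i b c ∘ proj₂)

  VariesOnlyAt-minor : ∀ {k} {a : Fin (suc k)} {b} {A : Carrier → Mat (suc (suc k))} →
    VariesOnlyAt (suc a) b A →
    ∀ j → VariesOnlyAt a (punchOut (punchInᵢ≢i b j)) (λ x → minor zero (punchIn b j) (A x))
  VariesOnlyAt-minor {b = b} varies j x y r c ne = varies x y (suc r) _ λ (sr≡sa , c≡b) →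
    ne (Fin.suc-injective sr≡sa ,
        punchIn-injective (punchIn b j) c _ (trans c≡b (sym (punchIn-punchOut (punchInᵢ≢i b j)))))

  -- Expand along row zero.  If the varying entry lies in a lower row, it sits at (a, punchOut)
  -- in each minor that avoids column b, and the induction hypothesis applies there.
  det-affine : ∀ {k} (a b : Fin (suc k)) (A : Carrier → Mat (suc k)) →
    (∀ x → A x a b ≡ x) → VariesOnlyAt a b A → ∀ y →
    Affine (λ x → det ℝ (A x)) (signFin ℝ a * signFin ℝ b * det ℝ (minor a b (A y)))
  det-affine zero b A A≡x varies y = R , λ x → begin
    det ℝ (A x)
      ≡⟨ sumFin-punchIn (laplace-term (A x)) b ⟩
    laplace-term (A x) b + sumFin ℝ (laplace-term (A x) ∘ punchIn b)
      ≡⟨ cong₂ _+_ (cong₂ (λ e d → signFin ℝ b * e * d) (A≡x x) (det-minor-row-stable varies b x y))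
                   (sumFin-cong λ j → cong₂ (λ e d → signFin ℝ (punchIn b j) * e * d)
                      (varies x y zero _ (punchInᵢ≢i b j ∘ proj₂))
                      (det-minor-row-stable varies (punchIn b j) x y)) ⟩
    signFin ℝ b * x * D + R
      ≡⟨ cong (_+ R) (solve 3 (λ s x d → (s ⊕ x) ⊕ d ⊜ ((id ⊕ s) ⊕ d) ⊕ x) refl (signFin ℝ b) x D) ⟩
    1# * signFin ℝ b * D * x + R ∎
    where
    D = det ℝ (minor zero b (A y))
    R = sumFin ℝ (laplace-term (A y) ∘ punchIn b)
  det-affine {suc k} (suc a) b A A≡x varies y =
    affine-resp (λ x → sym (expand x)) coefficient
      (affine-+ (affine-const (laplace-term (A y) b))
                (affine-sumFin λ j → affine-scale (weight j) (minor-affine j)))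
    where
    b′ : Fin (suc k) → Fin (suc k)
    b′ j = punchOut (punchInᵢ≢i b j)

    weight : Fin (suc k) → Carrier
    weight j = signFin ℝ (punchIn b j) * A y zero (punchIn b j)

    minor-coefficient : Fin (suc k) → Carrier
    minor-coefficient j =
      signFin ℝ a * signFin ℝ (b′ j) * det ℝ (minor a (b′ j) (minor zero (punchIn b j) (A y)))

    minor-affine : ∀ j → Affine (λ x → det ℝ (minor zero (punchIn b j) (A x))) (minor-coefficient j)
    minor-affine j = det-affine a (b′ j) (λ x → minor zero (punchIn b j) (A x))
      (λ x → trans (cong (A x (suc a)) (punchIn-punchOut (punchInᵢ≢i b j))) (A≡x x))
      (VariesOnlyAt-minor varies j) y

    expand : ∀ x → det ℝ (A x) ≡
      laplace-term (A y) b + sumFin ℝ (λ j → weight j * det ℝ (minor zero (punchIn b j) (A x)))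
    expand x = trans (sumFin-punchIn (laplace-term (A x)) b)
      (cong₂ _+_
        (cong₂ (λ e d → signFin ℝ b * e * d) (varies x y zero b (λ ())) (det-minor-col-stable varies zero x y))
        (sumFin-cong λ j → cong (λ e → signFin ℝ (punchIn b j) * e * det ℝ (minor zero (punchIn b j) (A x)))
                                (varies x y zero (punchIn b j) (λ ()))))

    coefficient : 0# + sumFin ℝ (λ j → weight j * minor-coefficient j) ≡
                  - signFin ℝ a * signFin ℝ b * det ℝ (minor (suc a) b (A y))
    coefficient = begin
      0# + sumFin ℝ (λ j → weight j * minor-coefficient j)  ≡⟨ +-identityˡ _ ⟩
      sumFin ℝ (λ j → weight j * minor-coefficient j)       ≡⟨ sumFin-cong term ⟩
      sumFin ℝ (λ j → σ * laplace-term A′ j)                 ≡⟨ sym (*-distribˡ-sumFin σ (laplace-term A′)) ⟩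
      σ * det ℝ A′                                           ∎
      where
      σ = - signFin ℝ a * signFin ℝ b
      A′ = minor (suc a) b (A y)
      term : ∀ j → weight j * minor-coefficient j ≡ σ * laplace-term A′ j
      term j = trans (cong (λ δ → weight j * (signFin ℝ a * signFin ℝ (b′ j) * δ)) d′≡d)
        (cofactor-sign-exchange (signFin ℝ a) (A y zero (punchIn b j)) (det ℝ (minor zero j A′))
          (signFin-punchIn-punchOut b j (punchInᵢ≢i b j)))
        where
        d′≡d : det ℝ (minor a (b′ j) (minor zero (punchIn b j) (A y))) ≡ det ℝ (minor zero j A′)
        d′≡d = det-cong λ r c →
          cong (A y (suc (punchIn a r))) (punchIn-punchIn-punchOut b j c (punchInᵢ≢i b j))

  SignParity : Carrier → ℕ → Set
  SignParity s n = (s ≡ 1# × n % 2 ≡ 0) ⊎ (s ≡ - 1# × n % 2 ≡ 1)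

  SignParity-suc : ∀ {s n} → SignParity s n → SignParity (- s) (suc n)
  SignParity-suc {n = n} (inj₁ (s≡1 , n%2≡0)) =
    inj₂ (cong -_ s≡1 , trans (%-distribˡ-+ 1 n 2) (cong (λ r → (1 +ℕ r) % 2) n%2≡0))
  SignParity-suc {n = n} (inj₂ (s≡-1 , n%2≡1)) =
    inj₁ (trans (cong -_ s≡-1) (-‿involutive 1#) ,
          trans (%-distribˡ-+ 1 n 2) (cong (λ r → (1 +ℕ r) % 2) n%2≡1))

  signFin-parity : ∀ {k} (a : Fin k) → SignParity (signFin ℝ a) (toℕ a)
  signFin-parity zero    = inj₁ (refl , refl)
  signFin-parity (suc a) = SignParity-suc {n = toℕ a} (signFin-parity a)

  signFin-*-parity : ∀ {k l} (a : Fin k) (b : Fin l) →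
                     SignParity (signFin ℝ a * signFin ℝ b) (toℕ a +ℕ toℕ b)
  signFin-*-parity zero    b = subst (λ s → SignParity s (toℕ b)) (sym (*-identityˡ _)) (signFin-parity b)
  signFin-*-parity (suc a) b =
    subst (λ s → SignParity s (suc (toℕ a +ℕ toℕ b))) (-‿distribˡ-* (signFin ℝ a) (signFin ℝ b))
      (SignParity-suc {n = toℕ a +ℕ toℕ b} (signFin-*-parity a b))

increasing-injective : ∀ {k m} (f : Fin k → Fin m) → (∀ a b → a <F b → f a <F f b) →
                       ∀ {a b} → f a ≡ f b → a ≡ b
increasing-injective f increasing {a} {b} fa≡fb with Fin.<-cmp a b
... | tri< a<b _ _ = ⊥-elim (Fin.<-irrefl fa≡fb (increasing a b a<b))
... | tri≈ _ a≡b _ = a≡b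
... | tri> _ _ b<a = ⊥-elim (Fin.<-irrefl (sym fa≡fb) (increasing b a b<a))

punchIn-mono-< : ∀ {k} (i : Fin (suc k)) {a b : Fin k} → a <F b → punchIn i a <F punchIn i b
punchIn-mono-< zero    a<b                   = s≤s a<b
punchIn-mono-< (suc i) {zero}  {suc b} _     = s≤s z≤n
punchIn-mono-< (suc i) {suc a} {suc b} (s≤s a<b) = s≤s (punchIn-mono-< i a<b)

just-fromMaybe : ∀ {C : Set} {d : C} (v : Maybe C) → v ≢ nothing → v ≡ just (fromMaybe d v)
just-fromMaybe (just x) _       = refl
just-fromMaybe nothing  v≢nothing = ⊥-elim (v≢nothing refl)

module Atoms (ℝ : RealField) {m n} (M : PMat ℝ m n) (tp : PartialTP ℝ M) (i : Fin m) (j : Fin n) where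

  open RealField ℝ
  open OrderedField ℝ
  open Determinant ℝ

  Satisfies : Carrier → SqSub ℝ m n → Set
  Satisfies x S = 0# < atomDet ℝ M (i , j) S x

  open HalfLines isStrictTotalOrder Satisfies
  open Helly isStrictTotalOrder unbounded-above unbounded-below 0# Satisfies

  fill-at : ∀ x {r c} → r ≡ i → c ≡ j → fill ℝ M (i , j) x r c ≡ just x
  fill-at x {r} {c} r≡i c≡j with (r ≟F i) ×-dec (c ≟F j)
  ... | yes _ = refl
  ... | no ne = ⊥-elim (ne (r≡i , c≡j))

  fill-off : ∀ x {r c} → ¬ (r ≡ i × c ≡ j) → fill ℝ M (i , j) x r c ≡ M r c
  fill-off x {r} {c} ne with (r ≟F i) ×-dec (c ≟F j)
  ... | yes eq = ⊥-elim (ne eq)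
  ... | no _   = refl

  atom-halfLine : ∀ S → IsAtom ℝ M (i , j) S →
    PositiveAtom ℝ (i , j) S × Above S ⊎ NegativeAtom ℝ (i , j) S × Below S
  atom-halfLine S (only-u , (a , b , unspecified) , _) = by-parity (signFin-*-parity a b)
    where
    R = rows S
    C = cols S

    at-u : (R a , C b) ≡ (i , j)
    at-u = only-u a b unspecified

    off-u : ∀ {r c} → ¬ (r ≡ a × c ≡ b) → ¬ (R r ≡ i × C c ≡ j)
    off-u ne (Rr≡i , Cc≡j) =
      ne (increasing-injective R (rowsInc S) (trans Rr≡i (sym (cong proj₁ at-u))) ,
          increasing-injective C (colsInc S) (trans Cc≡j (sym (cong proj₂ at-u))))

    entries : Carrier → Fin (suc (size S)) → Fin (suc (size S)) → Carrier
    entries x r c = fromMaybe 0# (fill ℝ M (i , j) x (R r) (C c))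

    varies : VariesOnlyAt a b entries
    varies x y r c ne = cong (fromMaybe 0#) (trans (fill-off x (off-u ne)) (sym (fill-off y (off-u ne))))

    D : Carrier
    D = det ℝ (minor a b (entries 0#))

    affine : Affine (λ x → det ℝ (entries x)) (signFin ℝ a * signFin ℝ b * D)
    affine = det-affine a b entries
      (λ x → cong (fromMaybe 0#) (fill-at x (cong proj₁ at-u) (cong proj₂ at-u))) varies 0#

    specified : ∀ r c → M (R (punchIn a r)) (C (punchIn b c)) ≡ just (minor a b (entries 0#) r c)
    specified r c = trans
      (just-fromMaybe _ (off-u (punchInᵢ≢i a r ∘ proj₁) ∘ ×-≡,≡←≡ ∘ only-u _ _))
      (cong (just ∘ fromMaybe 0#) (sym (fill-off 0# (off-u (punchInᵢ≢i a r ∘ proj₁)))))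

    0<D : 0# < D
    0<D = tp (size S) (R ∘ punchIn a) (C ∘ punchIn b)
      (λ r r′ r<r′ → rowsInc S _ _ (punchIn-mono-< a r<r′))
      (λ c c′ c<c′ → colsInc S _ _ (punchIn-mono-< b c<c′))
      (minor a b (entries 0#)) specified

    by-parity : SignParity (signFin ℝ a * signFin ℝ b) (toℕ a +ℕ toℕ b) →
      PositiveAtom ℝ (i , j) S × Above S ⊎ NegativeAtom ℝ (i , j) S × Below S
    by-parity (inj₁ (sign≡1 , even)) = inj₁ ((a , b , at-u , even) ,
      affine-above 0<D (subst (Affine _) (trans (cong (_* D) sign≡1) (*-identityˡ D)) affine))
    by-parity (inj₂ (sign≡-1 , odd)) = inj₂ ((a , b , at-u , odd) ,
      affine-below 0<D (subst (Affine _)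
        (trans (cong (_* D) sign≡-1) (trans (sym (-‿distribˡ-* 1# D)) (cong -_ (*-identityˡ D)))) affine))

  above-positive : ∀ S → IsAtom ℝ M (i , j) S → Above S → PositiveAtom ℝ (i , j) S
  above-positive S atom above with atom-halfLine S atom
  ... | inj₁ (positive , _) = positive
  ... | inj₂ (_ , below)    = ⊥-elim (above-below-disjoint S above below)

  below-negative : ∀ S → IsAtom ℝ M (i , j) S → Below S → NegativeAtom ℝ (i , j) S
  below-negative S atom below with atom-halfLine S atom
  ... | inj₁ (_ , above)    = ⊥-elim (above-below-disjoint S above below)
  ... | inj₂ (negative , _) = negative

  unsolvable-pair : ∀ A → All (IsAtom ℝ M (i , j)) A → ¬ Solvable ℝ M (i , j) A →
    ∃₂ λ P N → P ∈ A × N ∈ A × PositiveAtom ℝ (i , j) P × NegativeAtom ℝ (i , j) N ×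
               P ≢ N × ¬ Solvable ℝ M (i , j) (P ∷ N ∷ [])
  unsolvable-pair A atoms unsolvable =
    let (P , N , P∈ , N∈ , above-P , below-N , disjoint) =
          helly A (All.map (λ {S} → Sum.map proj₂ proj₂ ∘ atom-halfLine S) atoms) unsolvable
    in P , N , P∈ , N∈ , above-positive P (All.lookup atoms P∈) above-P ,
       below-negative N (All.lookup atoms N∈) below-N ,
       (λ P≡N → above-below-disjoint P above-P (subst Below (sym P≡N) below-N)) ,
       λ { (x , sat-P ∷ sat-N ∷ []) → disjoint (x , sat-P , sat-N) }

lemma4 : (ℝ : RealField) {m n : ℕ} (M : PMat ℝ m n) →
    PartialTP ℝ M →
    (i : Fin m) (j : Fin n) → M i j ≡ nothing →
    (∀ x → ¬ PartialTP ℝ (fill ℝ M (i , j) x)) →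
    (A : List (SqSub ℝ m n)) → Inhibiting ℝ M (i , j) A →
    length A ≡ 2 × Any (PositiveAtom ℝ (i , j)) A × Any (NegativeAtom ℝ (i , j)) A
lemma4 ℝ M tp i j _ _ A (atoms , unsolvable , minimal) =
  let (P , N , P∈ , N∈ , positive , negative , P≢N , unsolvable-PN) =
        Atoms.unsolvable-pair ℝ M tp i j A atoms unsolvable
  in ≤-antisym (minimal (P ∷ N ∷ []) (All.lookup atoms P∈ ∷ All.lookup atoms N∈ ∷ []) unsolvable-PN)
               (distinct-members⇒2≤length P∈ N∈ P≢N) ,
     lose P∈ positive , lose N∈ negative
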